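{- Let $w\in\mathfrak S_n$ and $R,S\in\mathrm{SBT}(w)$. If $R$ and $S$ both row sort to the same filling $T$, then $R=S$.
   Context: The Rothe diagram $\mathbb D(w)=\{(i,w_j)\mid i<j,\ w_i>w_j\}$, the cell $(i,w_j)$ lying in row $i$ (rows numbered bottom to top) and column $w_j$; it has $\ell(w)$ cells, where $\ell(w)$ is the number of pairs $i<j$ with $w_i>w_j$. A standard balanced tableau of shape $\mathbb D(w)$ is a bijective filling of its cells with $\{1,\ldots,\ell(w)\}$ such that for every cell, the number of cells to its right in the same row with larger entry equals the number of cells above it in the same column with smaller entry; $\mathrm{SBT}(w)$ is the set of these. Row sorting a filling means rearranging the entries within each row into decreasing order from left to right. -}

module Defs where

open import Data.Nat using (ℕ; _≤_; _≥_)
open import Data.Fin using (Fin; _<_; _<?_)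
open import Data.Fin.Properties using (_≟_)
open import Data.Fin.Permutation using (Permutation′; _⟨$⟩ʳ_)
open import Data.List using (List; length; filter; map; cartesianProduct; allFin)
open import Data.List.Membership.Propositional using (_∈_)
open import Data.List.Membership.DecPropositional using () renaming (_∈?_ to ∈?-gen)
open import Data.List.Relation.Unary.Linked using (Linked)
open import Data.List.Relation.Binary.Permutation.Propositional using (_↭_)
open import Data.Product using (_×_; _,_; proj₁; proj₂; ∃)
open import Data.Product.Properties using (≡-dec)
open import Relation.Binary.PropositionalEquality using (_≡_)
open import Relation.Nullary.Decidable using (_×-dec_)
import Data.Nat as ℕ

-- Conventions: indices are 0-based, Fin n = {0,…,n-1} stands for {1,…,n}.  Rows are numbered bottom to top, so
-- "above" means larger row index; "to the right" means larger column index.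

Cell : ℕ → Set
Cell n = Fin n × Fin n

row : ∀ {n} → Cell n → Fin n
row = proj₁

col : ∀ {n} → Cell n → Fin n
col = proj₂

inversions : ∀ {n} → Permutation′ n → List (Fin n × Fin n)
inversions {n} w =
  filter (λ p → (proj₁ p <? proj₂ p) ×-dec ((w ⟨$⟩ʳ proj₂ p) <? (w ⟨$⟩ʳ proj₁ p)))
         (cartesianProduct (allFin n) (allFin n))

ℓ : ∀ {n} → Permutation′ n → ℕ
ℓ w = length (inversions w)

rothe : ∀ {n} → Permutation′ n → List (Cell n)
rothe w = map (λ p → (proj₁ p , w ⟨$⟩ʳ proj₂ p)) (inversions w)

-- A filling assigns a natural number to every cell (only values on D(w) matter).
Filling : ℕ → Set
Filling n = Cell n → ℕ

record IsSBT {n : ℕ} (w : Permutation′ n) (F : Filling n) : Set where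
  field
    injective : ∀ {x y} → x ∈ rothe w → y ∈ rothe w → F x ≡ F y → x ≡ y
    inRange   : ∀ {x} → x ∈ rothe w → 1 ≤ F x × F x ≤ ℓ w
    surjective : ∀ k → 1 ≤ k → k ≤ ℓ w → ∃ λ x → x ∈ rothe w × F x ≡ k
    balanced  : ∀ {x} → x ∈ rothe w →
      length (filter (λ y → (row y ≟ row x) ×-dec ((col x <? col y) ×-dec (F x ℕ.<? F y))) (rothe w))
      ≡ length (filter (λ y → (col y ≟ col x) ×-dec ((row x <? row y) ×-dec (F y ℕ.<? F x))) (rothe w))

_∈D?_ : ∀ {n} → (x : Cell n) → (w : Permutation′ n) → _
x ∈D? w = ∈?-gen (≡-dec _≟_ _≟_) x (rothe w)

rowCols : ∀ {n} → Permutation′ n → Fin n → List (Fin n)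
rowCols {n} w r = filter (λ c → (r , c) ∈D? w) (allFin n)

rowEntries : ∀ {n} → Permutation′ n → Filling n → Fin n → List ℕ
rowEntries w F r = map (λ c → F (r , c)) (rowCols w r)

RowSortsTo : ∀ {n} → Permutation′ n → Filling n → Filling n → Set
RowSortsTo {n} w F T = ∀ (r : Fin n) →
  rowEntries w F r ↭ rowEntries w T r × Linked _≥_ (rowEntries w T r)

module Submission where

-- Two balanced fillings of a Rothe diagram whose rows hold the same
-- multisets of entries coincide; Lemma 3.20 is the special case of two
-- standard balanced tableaux that row sort to a common filling T.
--
-- For a filling F, a cell x and a value v, let rightLarger F x v count the
-- cells of D(w) in the row of x, weakly right of x, with entry > v, and let
-- aboveSmaller F x v count the cells above x in its column with entry < v.
-- Balancedness at x says  rightLarger F x (F x) = aboveSmaller F x (F x).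
--
-- We show R x = S x for every cell x, by induction from the top row down
-- and, within a row, from left to right.  If R and S agree above x and to
-- the left of x in its row, then the equal row multisets give
-- rightLarger R x = rightLarger S x, and aboveSmaller R x = aboveSmaller S x.
-- Were R x < S x, the chain
--   aboveSmaller S x (S x) = rightLarger S x (S x) < rightLarger S x (R x)
--     = rightLarger R x (R x) = aboveSmaller R x (R x) ≤ aboveSmaller S x (S x)
-- would be contradictory (the strict step counts the cell x itself);
-- symmetrically R x > S x is impossible.

open import Defs
open import Data.Nat using (ℕ; suc; _+_; _≤_)
import Data.Nat as ℕ
import Data.Nat.Properties as ℕP
open import Data.Fin using (Fin; _<_; _>_; _<?_)
open import Data.Fin.Properties using (_≟_)
import Data.Fin.Properties as FinP
open import Data.Fin.Induction using (>-wellFounded; <-wellFounded)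
open import Data.Fin.Permutation using (Permutation′; _⟨$⟩ʳ_)
open import Data.List using (List; []; _∷_; length; filter; map; allFin)
open import Data.List.Properties using (length-map; filter-some; filter-none)
open import Data.List.Membership.Propositional using (_∈_)
open import Data.List.Membership.Propositional.Properties using (∈-filter⁺; ∈-filter⁻; ∈-map⁺; ∈-map⁻; ∈-allFin)
open import Data.List.Membership.Propositional.Properties.WithK using (unique∧set⇒bag)
open import Data.List.Relation.Unary.Any using (here; there)
import Data.List.Relation.Unary.Any as Any
import Data.List.Relation.Unary.All as All
open import Data.List.Relation.Unary.Unique.Propositional using (Unique)
import Data.List.Relation.Unary.Unique.Propositional.Properties as Unique
open import Data.List.Relation.Binary.BagAndSetEquality using (∼bag⇒↭)
open import Data.List.Relation.Binary.Permutation.Propositional using (_↭_; ↭-trans; ↭-sym)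
open import Data.List.Relation.Binary.Permutation.Propositional.Properties using (↭-length; filter-↭)
open import Data.List.Relation.Binary.Sublist.Propositional using (⊆-refl)
open import Data.List.Relation.Binary.Sublist.Propositional.Properties using (length-mono-≤; filter⁺)
open import Data.Product using (_×_; _,_; proj₁; proj₂)
open import Data.Product.Properties using (,-injectiveˡ; ,-injectiveʳ)
open import Function.Bundles using (_⇔_; mk⇔; Injection)
open import Function.Properties.Inverse using (↔⇒↣)
open import Relation.Binary.PropositionalEquality using (_≡_; refl; sym; trans; cong; cong₂; subst; module ≡-Reasoning)
open import Relation.Binary.Definitions using (tri<; tri≈; tri>)
open import Relation.Nullary using (¬_; yes; no; ¬?; contradiction)
open import Relation.Nullary.Decidable using (_×-dec_)
open import Relation.Unary using (Decidable)
open import Induction.WellFounded using (Acc; acc)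

count : {A : Set} {P : A → Set} → Decidable P → List A → ℕ
count P? xs = length (filter P? xs)

module Counting {A : Set} where

  count-cong : {P Q : A → Set} (P? : Decidable P) (Q? : Decidable Q) (xs : List A) →
    (∀ {y} → y ∈ xs → P y → Q y) → (∀ {y} → y ∈ xs → Q y → P y) →
    count P? xs ≡ count Q? xs
  count-cong P? Q? [] _ _ = refl
  count-cong P? Q? (x ∷ xs) p⇒q q⇒p with P? x | Q? x
  ... | yes _ | yes _ = cong suc (count-cong P? Q? xs (λ m → p⇒q (there m)) (λ m → q⇒p (there m)))
  ... | yes p | no ¬q = contradiction (p⇒q (here refl) p) ¬q
  ... | no ¬p | yes q = contradiction (q⇒p (here refl) q) ¬p
  ... | no _  | no _  = count-cong P? Q? xs (λ m → p⇒q (there m)) (λ m → q⇒p (there m))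

  count-mono : {P Q : A → Set} (P? : Decidable P) (Q? : Decidable Q) (xs : List A) →
    (∀ {y} → P y → Q y) → count P? xs ≤ count Q? xs
  count-mono P? Q? xs p⇒q = length-mono-≤ (filter⁺ P? Q? (λ { refl → p⇒q }) (⊆-refl {x = xs}))

  count-pos : {P : A → Set} (P? : Decidable P) (xs : List A) {y : A} →
    y ∈ xs → P y → 1 ≤ count P? xs
  count-pos P? xs y∈xs py = filter-some P? (Any.map (λ { refl → py }) y∈xs)

  count-none : {P : A → Set} (P? : Decidable P) (xs : List A) →
    (∀ {y} → y ∈ xs → ¬ P y) → count P? xs ≡ 0
  count-none P? xs none = cong length (filter-none P? (All.tabulate none))

  count-split : {P Q : A → Set} (P? : Decidable P) (Q? : Decidable Q) (xs : List A) →
    count P? xs ≡ count (λ y → P? y ×-dec Q? y) xs + count (λ y → P? y ×-dec ¬? (Q? y)) xs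
  count-split P? Q? [] = refl
  count-split P? Q? (x ∷ xs) with P? x | Q? x
  ... | yes _ | yes _ = cong suc (count-split P? Q? xs)
  ... | yes _ | no _  = trans (cong suc (count-split P? Q? xs)) (sym (ℕP.+-suc _ _))
  ... | no _  | yes _ = count-split P? Q? xs
  ... | no _  | no _  = count-split P? Q? xs

  count-map : {B : Set} {P : B → Set} (P? : Decidable P) (f : A → B) (xs : List A) →
    count P? (map f xs) ≡ count (λ x → P? (f x)) xs
  count-map P? f [] = refl
  count-map P? f (x ∷ xs) with P? (f x)
  ... | yes _ = cong suc (count-map P? f xs)
  ... | no _  = count-map P? f xs

  unique-length : {xs ys : List A} → Unique xs → Unique ys →
    (∀ {z} → z ∈ xs ⇔ z ∈ ys) → length xs ≡ length ys
  unique-length ux uy same = ↭-length (∼bag⇒↭ (unique∧set⇒bag ux uy same))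

open Counting

module Rothe {n : ℕ} (w : Permutation′ n) where

  D : List (Cell n)
  D = rothe w

  -- D(w) lists each cell once, because (i , j) ↦ (i , w j) is injective.
  D-unique : Unique D
  D-unique = Unique.map⁺ cellOf-injective
    (Unique.filter⁺ _ (Unique.cartesianProduct⁺ (Unique.allFin⁺ n) (Unique.allFin⁺ n)))
    where
    cellOf-injective : ∀ {p q : Fin n × Fin n} →
      (proj₁ p , w ⟨$⟩ʳ proj₂ p) ≡ (proj₁ q , w ⟨$⟩ʳ proj₂ q) → p ≡ q
    cellOf-injective eq = cong₂ _,_ (,-injectiveˡ eq) (Injection.injective (↔⇒↣ w) (,-injectiveʳ eq))

  -- Counting the cells of row r of D(w) by a property of their entries is
  -- the same as counting the entries of row r with that property: both
  -- sides enumerate, without repetition, the same cells (r , c).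
  row-count : (F : Filling n) (r : Fin n) {P : ℕ → Set} (P? : Decidable P) →
    count (λ y → (row y ≟ r) ×-dec P? (F y)) D ≡ count P? (rowEntries w F r)
  row-count F r {P} P? = begin
    length (filter InRow? D)     ≡⟨ unique-length (Unique.filter⁺ InRow? D-unique) cells-unique (mk⇔ to from) ⟩
    length (map (r ,_) cols)     ≡⟨ length-map (r ,_) cols ⟩
    length cols                  ≡⟨ sym (count-map P? (λ c → F (r , c)) (rowCols w r)) ⟩
    count P? (rowEntries w F r)  ∎
    where
    open ≡-Reasoning
    InRow? : Decidable (λ y → row y ≡ r × P (F y))
    InRow? y = (row y ≟ r) ×-dec P? (F y)
    InD? : Decidable (λ c → (r , c) ∈ D)
    InD? c = (r , c) ∈D? w
    Holds? : Decidable (λ c → P (F (r , c)))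
    Holds? c = P? (F (r , c))
    cols : List (Fin n)
    cols = filter Holds? (rowCols w r)
    cells-unique : Unique (map (r ,_) cols)
    cells-unique = Unique.map⁺ ,-injectiveʳ (Unique.filter⁺ Holds? (Unique.filter⁺ InD? (Unique.allFin⁺ n)))
    to : ∀ {y} → y ∈ filter InRow? D → y ∈ map (r ,_) cols
    to {_ , c} y∈ with ∈-filter⁻ InRow? y∈
    ... | y∈D , (refl , py) = ∈-map⁺ (r ,_) (∈-filter⁺ Holds? (∈-filter⁺ InD? (∈-allFin c) y∈D) py)
    from : ∀ {y} → y ∈ map (r ,_) cols → y ∈ filter InRow? D
    from y∈ with ∈-map⁻ (r ,_) y∈
    ... | c , c∈cols , refl with ∈-filter⁻ Holds? {xs = rowCols w r} c∈cols
    ... | c∈row , py = ∈-filter⁺ InRow? (proj₂ (∈-filter⁻ InD? {xs = allFin n} c∈row)) (refl , py)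

  rowLarger : Filling n → Fin n → ℕ → ℕ
  rowLarger F r v = count (λ y → (row y ≟ r) ×-dec (v ℕ.<? F y)) D

  leftLarger : Filling n → Cell n → ℕ → ℕ
  leftLarger F x v = count (λ y → ((row y ≟ row x) ×-dec (v ℕ.<? F y)) ×-dec (col y <? col x)) D

  rightLarger : Filling n → Cell n → ℕ → ℕ
  rightLarger F x v = count (λ y → ((row y ≟ row x) ×-dec (v ℕ.<? F y)) ×-dec ¬? (col y <? col x)) D

  aboveSmaller : Filling n → Cell n → ℕ → ℕ
  aboveSmaller F x v = count (λ y → (col y ≟ col x) ×-dec ((row x <? row y) ×-dec (F y ℕ.<? v))) D

  Balanced : Filling n → Set
  Balanced F = ∀ {x} → x ∈ D →
    count (λ y → (row y ≟ row x) ×-dec ((col x <? col y) ×-dec (F x ℕ.<? F y))) D ≡ aboveSmaller F x (F x)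

  -- Balancedness in terms of rightLarger: the cell x itself is never
  -- counted in rightLarger F x (F x), so weakly right means strictly right.
  balanced-right : (F : Filling n) → Balanced F → ∀ {x} → x ∈ D →
    rightLarger F x (F x) ≡ aboveSmaller F x (F x)
  balanced-right F balanced {x} x∈D = begin
    rightLarger F x (F x)
      ≡⟨ count-split WeaklyRight? (λ y → col x <? col y) D ⟩
    count (λ y → WeaklyRight? y ×-dec (col x <? col y)) D + count (λ y → WeaklyRight? y ×-dec ¬? (col x <? col y)) D
      ≡⟨ cong₂ _+_ strictly-right (count-none _ D (λ _ → only-x)) ⟩
    count (λ y → (row y ≟ row x) ×-dec ((col x <? col y) ×-dec (F x ℕ.<? F y))) D + 0
      ≡⟨ ℕP.+-identityʳ _ ⟩
    count (λ y → (row y ≟ row x) ×-dec ((col x <? col y) ×-dec (F x ℕ.<? F y))) D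
      ≡⟨ balanced x∈D ⟩
    aboveSmaller F x (F x) ∎
    where
    open ≡-Reasoning
    WeaklyRight? : Decidable (λ y → ((row y ≡ row x) × (F x ℕ.< F y)) × ¬ (col y < col x))
    WeaklyRight? y = ((row y ≟ row x) ×-dec (F x ℕ.<? F y)) ×-dec ¬? (col y <? col x)
    strictly-right : count (λ y → WeaklyRight? y ×-dec (col x <? col y)) D
      ≡ count (λ y → (row y ≟ row x) ×-dec ((col x <? col y) ×-dec (F x ℕ.<? F y))) D
    strictly-right = count-cong _ _ D
      (λ _ → λ { (((r , lt) , _) , c<) → r , (c< , lt) })
      (λ _ → λ { (r , (c< , lt)) → ((r , lt) , FinP.<-asym c<) , c< })
    only-x : ∀ {y} → ¬ ((((row y ≡ row x) × (F x ℕ.< F y)) × ¬ (col y < col x)) × ¬ (col x < col y))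
    only-x {y} (((r , lt) , ≮) , ≯) =
      ℕP.<-irrefl (cong F (cong₂ _,_ (sym r) (FinP.≤-antisym (ℕP.≮⇒≥ ≮) (ℕP.≮⇒≥ ≯)))) lt

  SameRows : Filling n → Filling n → Set
  SameRows R S = ∀ r → rowEntries w R r ↭ rowEntries w S r

  AgreeAbove : Filling n → Filling n → Cell n → Set
  AgreeAbove R S x = ∀ {y} → y ∈ D → row x < row y → R y ≡ S y

  AgreeLeft : Filling n → Filling n → Cell n → Set
  AgreeLeft R S x = ∀ {y} → y ∈ D → row y ≡ row x → col y < col x → R y ≡ S y

  rowLarger-sameRows : (R S : Filling n) → SameRows R S → ∀ r v → rowLarger R r v ≡ rowLarger S r v
  rowLarger-sameRows R S same r v = begin
    rowLarger R r v                              ≡⟨ row-count R r (v ℕ.<?_) ⟩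
    count (v ℕ.<?_) (rowEntries w R r)           ≡⟨ ↭-length (filter-↭ (v ℕ.<?_) (same r)) ⟩
    count (v ℕ.<?_) (rowEntries w S r)           ≡⟨ sym (row-count S r (v ℕ.<?_)) ⟩
    rowLarger S r v                              ∎
    where open ≡-Reasoning

  -- With equal row multisets and agreement left of x, the counts weakly
  -- right of x agree for every threshold: the row count splits into the
  -- left part and the weakly-right part, and the left parts agree.
  rightLarger-agree : (R S : Filling n) → SameRows R S → ∀ {x} → AgreeLeft R S x →
    ∀ v → rightLarger R x v ≡ rightLarger S x v
  rightLarger-agree R S same {x} left v = ℕP.+-cancelˡ-≡ (leftLarger R x v) _ _ (begin
    leftLarger R x v + rightLarger R x v ≡⟨ sym (count-split (λ y → (row y ≟ row x) ×-dec (v ℕ.<? R y)) (λ y → col y <? col x) D) ⟩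
    rowLarger R (row x) v               ≡⟨ rowLarger-sameRows R S same (row x) v ⟩
    rowLarger S (row x) v               ≡⟨ count-split (λ y → (row y ≟ row x) ×-dec (v ℕ.<? S y)) (λ y → col y <? col x) D ⟩
    leftLarger S x v + rightLarger S x v ≡⟨ cong (_+ rightLarger S x v) (sym left-agree) ⟩
    leftLarger R x v + rightLarger S x v ∎)
    where
    open ≡-Reasoning
    left-agree : leftLarger R x v ≡ leftLarger S x v
    left-agree = count-cong _ _ D
      (λ y∈D → λ { ((r , lt) , c<) → (r , subst (v ℕ.<_) (left y∈D r c<) lt) , c< })
      (λ y∈D → λ { ((r , lt) , c<) → (r , subst (v ℕ.<_) (sym (left y∈D r c<)) lt) , c< })

  aboveSmaller-agree : (R S : Filling n) → ∀ {x} → AgreeAbove R S x →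
    ∀ v → aboveSmaller R x v ≡ aboveSmaller S x v
  aboveSmaller-agree R S above v = count-cong _ _ D
    (λ y∈D → λ { (c , (r< , lt)) → c , (r< , subst (ℕ._< v) (above y∈D r<) lt) })
    (λ y∈D → λ { (c , (r< , lt)) → c , (r< , subst (ℕ._< v) (sym (above y∈D r<)) lt) })

  aboveSmaller-mono : (F : Filling n) (x : Cell n) {a b : ℕ} → a ≤ b → aboveSmaller F x a ≤ aboveSmaller F x b
  aboveSmaller-mono F x a≤b = count-mono _ _ D (λ { (c , (r< , lt)) → c , (r< , ℕP.<-≤-trans lt a≤b) })

  -- Lowering the threshold below F x strictly increases rightLarger F x,
  -- since the cell x itself starts being counted.
  rightLarger-drop : (F : Filling n) → ∀ {x} → x ∈ D → ∀ {a} → a ℕ.< F x →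
    rightLarger F x (F x) ℕ.< rightLarger F x a
  rightLarger-drop F {x} x∈D {a} a<Fx = begin-strict
    rightLarger F x (F x)                           ≡⟨ above-Fx ⟩
    count (λ y → Q? y ×-dec (F x ℕ.<? F y)) D       <⟨ ℕP.m<m+n _ (count-pos _ D x∈D own) ⟩
    count (λ y → Q? y ×-dec (F x ℕ.<? F y)) D + count (λ y → Q? y ×-dec ¬? (F x ℕ.<? F y)) D
                                                    ≡⟨ sym (count-split Q? (λ y → F x ℕ.<? F y) D) ⟩
    rightLarger F x a                               ∎
    where
    open ℕP.≤-Reasoning
    Q? : Decidable (λ y → ((row y ≡ row x) × (a ℕ.< F y)) × ¬ (col y < col x))
    Q? y = ((row y ≟ row x) ×-dec (a ℕ.<? F y)) ×-dec ¬? (col y <? col x)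
    above-Fx : rightLarger F x (F x) ≡ count (λ y → Q? y ×-dec (F x ℕ.<? F y)) D
    above-Fx = count-cong _ _ D
      (λ _ → λ { ((r , lt) , c≮) → (((r , ℕP.<-trans a<Fx lt) , c≮) , lt) })
      (λ _ → λ { (((r , _) , c≮) , lt) → ((r , lt) , c≮) })
    own : (((row x ≡ row x) × (a ℕ.< F x)) × ¬ (col x < col x)) × ¬ (F x ℕ.< F x)
    own = ((refl , a<Fx) , FinP.<-irrefl refl) , ℕP.<-irrefl refl

  not-smaller : (R S : Filling n) → Balanced R → Balanced S → SameRows R S →
    ∀ {x} → x ∈ D → AgreeAbove R S x → AgreeLeft R S x → ¬ (R x ℕ.< S x)
  not-smaller R S balR balS same {x} x∈D above left Rx<Sx = ℕP.<-irrefl refl (begin-strict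
    aboveSmaller S x (S x) ≡⟨ sym (balanced-right S balS x∈D) ⟩
    rightLarger S x (S x)  <⟨ rightLarger-drop S x∈D Rx<Sx ⟩
    rightLarger S x (R x)  ≡⟨ sym (rightLarger-agree R S same left (R x)) ⟩
    rightLarger R x (R x)  ≡⟨ balanced-right R balR x∈D ⟩
    aboveSmaller R x (R x) ≡⟨ aboveSmaller-agree R S above (R x) ⟩
    aboveSmaller S x (R x) ≤⟨ aboveSmaller-mono S x (ℕP.<⇒≤ Rx<Sx) ⟩
    aboveSmaller S x (S x) ∎)
    where open ℕP.≤-Reasoning

  agree-at : (R S : Filling n) → Balanced R → Balanced S → SameRows R S →
    ∀ {x} → x ∈ D → AgreeAbove R S x → AgreeLeft R S x → R x ≡ S x
  agree-at R S balR balS same {x} x∈D above left with ℕP.<-cmp (R x) (S x)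
  ... | tri< Rx<Sx _ _ = contradiction Rx<Sx (not-smaller R S balR balS same x∈D above left)
  ... | tri≈ _ Rx≡Sx _ = Rx≡Sx
  ... | tri> _ _ Sx<Rx = contradiction Sx<Rx
    (not-smaller S R balS balR (λ r → ↭-sym (same r)) x∈D
      (λ y∈D r< → sym (above y∈D r<)) (λ y∈D r≡ c< → sym (left y∈D r≡ c<)))

cell-induction : ∀ {n} {P : Cell n → Set} →
  (∀ x → (∀ y → row x < row y → P y) → (∀ y → row y ≡ row x → col y < col x → P y) → P x) →
  ∀ x → P x
cell-induction {P = P} step (r , c) = at r (>-wellFounded r) c (<-wellFounded c)
  where
  at : ∀ r → Acc _>_ r → ∀ c → Acc _<_ c → P (r , c)
  at r (acc higher) c (acc lefter) = step (r , c)
    (λ y r<r′ → at (row y) (higher r<r′) (col y) (<-wellFounded (col y)))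
    (λ y r≡ c′<c → subst (λ q → P (q , col y)) (sym r≡) (at r (acc higher) (col y) (lefter c′<c)))

balanced-unique : ∀ {n} (w : Permutation′ n) (R S : Filling n) →
  Rothe.Balanced w R → Rothe.Balanced w S → Rothe.SameRows w R S →
  ∀ {x} → x ∈ rothe w → R x ≡ S x
balanced-unique w R S balR balS same {x} =
  cell-induction (λ z above left z∈D →
    agree-at R S balR balS same z∈D (λ y∈D r< → above _ r< y∈D) (λ y∈D r≡ c< → left _ r≡ c< y∈D)) x
  where open Rothe w

lemma3p20 : ∀ {n : ℕ} (w : Permutation′ n) (R S T : Filling n) →
    IsSBT w R → IsSBT w S → RowSortsTo w R T → RowSortsTo w S T →
    ∀ {x} → x ∈ rothe w → R x ≡ S x
lemma3p20 w R S T sbtR sbtS sortR sortS =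
  balanced-unique w R S (IsSBT.balanced sbtR) (IsSBT.balanced sbtS) same-rows
  where
  same-rows : Rothe.SameRows w R S
  same-rows r = ↭-trans (proj₁ (sortR r)) (↭-sym (proj₁ (sortS r)))
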